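{- Let $n\ge 6$, let $L$ be a 3-uniform list assignment of $\Pi_n$, and let $c$ be a proper lex-min $L$-coloring of $\Pi_n$. If the lists $L(v)$ are all the same, then $c$ is $\lceil 2n/3\rceil$-bounded, i.e. every color class of $c$ has at most $\lceil 2n/3\rceil$ vertices.
   Context: $\Pi_n=C_n\square K_2$ has vertices $u_1,\dots,u_n,v_1,\dots,v_n$ and edges $u_iu_{i+1}$, $v_iv_{i+1}$ (indices mod $n$) and $u_iv_i$. A 3-uniform list assignment gives each vertex a set $L(v)$ of exactly 3 colors; a proper $L$-coloring is a proper coloring with $c(v)\in L(v)$. For a proper $L$-coloring $c$ with nonempty color classes $C_1,\dots,C_r$ ordered so that $|C_1|\ge|C_2|\ge\cdots\ge|C_r|$, the color word is $w_c=n_1n_2\cdots n_r$ with $n_i=|C_i|$. The coloring $c$ is lex-min if its color word is lexicographically minimum among all proper $L$-colorings: for every proper $L$-coloring $c'$ with color word $m_1\cdots m_s$, either $w_c=w_{c'}$ or there is $k$ ($1\le k\le s$) with $n_i=m_i$ for $i<k$ and $n_k<m_k$. -}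

module Defs where

open import Data.Nat using (ℕ; zero; suc; _+_; _*_; _≤_; _<_; _≤ᵇ_; _/_)
open import Data.Nat.Properties using (_≟_)
open import Data.Bool using (Bool; true; false; if_then_else_)
open import Data.Fin using (Fin; toℕ)
open import Data.List using (List; []; _∷_; length; map; filter; deduplicate; allFin; concatMap)
open import Data.List.Relation.Unary.Unique.Propositional using (Unique)
open import Data.List.Membership.Propositional using (_∈_)
open import Data.Product using (_×_; _,_)
open import Data.Sum using (_⊎_)
open import Relation.Binary.PropositionalEquality using (_≡_; _≢_)

-- Vertices of the prism Π_n = C_n □ K_2 : (false , i) is u_{i+1}, (true , i) is v_{i+1}.
Vertex : ℕ → Set
Vertex n = Bool × Fin n

allVertices : (n : ℕ) → List (Vertex n)
allVertices n = concatMap (λ b → map (λ i → (b , i)) (allFin n)) (true ∷ false ∷ [])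

CycAdj : (n : ℕ) → Fin n → Fin n → Set
CycAdj n i j =
  toℕ j ≡ suc (toℕ i) ⊎ toℕ i ≡ suc (toℕ j)
  ⊎ (toℕ i ≡ 0 × suc (toℕ j) ≡ n) ⊎ (toℕ j ≡ 0 × suc (toℕ i) ≡ n)

Adj : (n : ℕ) → Vertex n → Vertex n → Set
Adj n (b , i) (b' , j) = (b ≡ b' × CycAdj n i j) ⊎ (b ≢ b' × i ≡ j)

ThreeUniform : (n : ℕ) → (Vertex n → List ℕ) → Set
ThreeUniform n L = ∀ v → length (L v) ≡ 3 × Unique (L v)

ProperLColoring : (n : ℕ) → (Vertex n → List ℕ) → (Vertex n → ℕ) → Set
ProperLColoring n L c = (∀ v → c v ∈ L v) × (∀ u v → Adj n u v → c u ≢ c v)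

classSize : (n : ℕ) → (Vertex n → ℕ) → ℕ → ℕ
classSize n c k = length (filter (λ v → c v ≟ k) (allVertices n))

insertDesc : ℕ → List ℕ → List ℕ
insertDesc x [] = x ∷ []
insertDesc x (y ∷ ys) = if y ≤ᵇ x then x ∷ y ∷ ys else y ∷ insertDesc x ys

sortDesc : List ℕ → List ℕ
sortDesc [] = []
sortDesc (x ∷ xs) = insertDesc x (sortDesc xs)

usedColours : (n : ℕ) → (Vertex n → ℕ) → List ℕ
usedColours n c = deduplicate _≟_ (map c (allVertices n))

colorWord : (n : ℕ) → (Vertex n → ℕ) → List ℕ
colorWord n c = sortDesc (map (classSize n c) (usedColours n c))

-- strict lexicographic order as in the paper: there is k (position existing
-- in both words) with equal entries before k and n_k < m_k
data LexLt : List ℕ → List ℕ → Set where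
  here  : ∀ {a b as bs} → a < b → LexLt (a ∷ as) (b ∷ bs)
  there : ∀ {a as bs} → LexLt as bs → LexLt (a ∷ as) (a ∷ bs)

LexMin : (n : ℕ) → (Vertex n → List ℕ) → (Vertex n → ℕ) → Set
LexMin n L c = ∀ c' → ProperLColoring n L c' →
  colorWord n c ≡ colorWord n c' ⊎ LexLt (colorWord n c) (colorWord n c')

-- ⌈2n/3⌉ = ⌊(2n+2)/3⌋
ceil2n/3 : ℕ → ℕ
ceil2n/3 n = (2 * n + 2) / 3

Bounded : (n : ℕ) → (Vertex n → ℕ) → ℕ → Set
Bounded n c b = ∀ k → classSize n c k ≤ b

-- All lists equal one 3-set S, so every proper S-colouring is a proper L-colouring; and since
-- lex-minimality first compares the leading letters of colour words, i.e. the largest class sizes,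
-- it suffices to exhibit one proper S-colouring whose classes have at most ⌈2n/3⌉ vertices.
-- Colour u_1, …, u_n by three colours cyclically (recolouring u_n if it clashes with u_1) and give
-- v_j the colour after that of u_j. Each column {u_j, v_j} meets a colour t at most once and misses
-- it whenever u_j has the colour after t, which happens in at least ⌊n/3⌋ columns; hence every
-- class has at most n − ⌊n/3⌋ = ⌈2n/3⌉ vertices.

module Submission where

open import Defs
open import Data.Nat using (ℕ; zero; suc; _+_; _*_; _≤_; _<_; _⊔_; _≤ᵇ_; _/_; _≤′_; ≤′-refl; ≤′-step; z≤n; s≤s)
open import Data.Nat.Properties
open import Data.Nat.DivMod using (m/n≡1+[m∸n]/n; m/n*n≤m)
open import Data.Nat.Tactic.RingSolver using (solve-∀)
open import Data.Bool using (true; false)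
open import Data.Fin using (Fin; toℕ; zero; suc; fromℕ<)
open import Data.Fin.Properties using (toℕ<n) renaming (_≟_ to _≟ᶠ_)
open import Data.List using (List; []; _∷_; [_]; _++_; length; filter; map; lookup; allFin; tabulate; applyUpTo; upTo)
open import Data.List.Properties using (filter-++; filter-accept; filter-none; length-++; length-filter; length-tabulate; map-tabulate; upTo-∷ʳ; ++-identityʳ)
open import Data.List.Relation.Unary.Any using (here; there; index)
open import Data.List.Relation.Unary.Any.Properties using (lookup-index)
open import Data.List.Relation.Unary.All as All using (All; []; _∷_)
open import Data.List.Relation.Unary.All.Properties using (applyUpTo⁺₁; map⁺)
open import Data.List.Relation.Unary.AllPairs using (_∷_)
open import Data.List.Relation.Unary.Unique.Propositional using (Unique)
open import Data.List.Membership.Propositional using (_∈_)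
open import Data.List.Membership.Propositional.Properties using (∈-lookup; ∈-map⁺; ∈-filter⁻; ∈-deduplicate⁺)
open import Data.List.Membership.DecPropositional _≟_ using (_∈?_)
open import Data.Product using (Σ; _×_; _,_)
open import Data.Sum using (_⊎_; inj₁; inj₂)
open import Function using (_∘_)
open import Level using (Level)
open import Relation.Nullary using (¬_; yes; no; contradiction)
open import Relation.Nullary.Reflects using (ofʸ; ofⁿ)
open import Relation.Unary using (Pred; Decidable)
open import Relation.Unary.Properties using (_∪?_)
open import Relation.Binary.PropositionalEquality hiding ([_])

private
  variable
    a b ℓ ℓ' : Level
    A : Set a
    B : Set b

count : {P : Pred A ℓ} → Decidable P → List A → ℕ
count P? xs = length (filter P? xs)

module _ {P : Pred A ℓ} (P? : Decidable P) where

  count-++ : ∀ xs ys → count P? (xs ++ ys) ≡ count P? xs + count P? ys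
  count-++ xs ys = trans (cong length (filter-++ P? xs ys)) (length-++ (filter P? xs))

  count-map : (f : B → A) → ∀ xs → count P? (map f xs) ≡ count (P? ∘ f) xs
  count-map f [] = refl
  count-map f (x ∷ xs) with P? (f x)
  ... | yes _ = cong suc (count-map f xs)
  ... | no _ = count-map f xs

module _ {P : Pred ℕ ℓ} (P? : Decidable P) where

  count-upTo-suc : ∀ m → count P? (upTo (suc m)) ≡ count P? (upTo m) + count P? [ m ]
  count-upTo-suc m = trans (cong (count P?) (sym (upTo-∷ʳ m))) (count-++ P? (upTo m) [ m ])

  count-upTo-hit : ∀ {m} → P m → count P? (upTo (suc m)) ≡ suc (count P? (upTo m))
  count-upTo-hit {m} Pm = begin
    count P? (upTo (suc m))           ≡⟨ count-upTo-suc m ⟩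
    count P? (upTo m) + count P? [ m ] ≡⟨ cong (λ ys → count P? (upTo m) + length ys) (filter-accept P? Pm) ⟩
    count P? (upTo m) + 1             ≡⟨ +-comm _ 1 ⟩
    suc (count P? (upTo m))           ∎
    where open ≡-Reasoning

  count-upTo-mono : ∀ {m m'} → m ≤ m' → count P? (upTo m) ≤ count P? (upTo m')
  count-upTo-mono = go ∘ ≤⇒≤′
    where
    go : ∀ {m m'} → m ≤′ m' → count P? (upTo m) ≤ count P? (upTo m')
    go ≤′-refl = ≤-refl
    go (≤′-step {m'} m≤′m') = ≤-trans (go m≤′m') (≤-trans (m≤m+n _ _) (≤-reflexive (sym (count-upTo-suc m'))))

module _ {P : Pred A ℓ} {Q : Pred A ℓ'} (P? : Decidable P) (Q? : Decidable Q) where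

  count-mono : ∀ {xs} → All (λ x → P x → Q x) xs → count P? xs ≤ count Q? xs
  count-mono {[]} [] = z≤n
  count-mono {x ∷ xs} (P⇒Q ∷ rest) with P? x | Q? x
  ... | yes Px | yes _ = s≤s (count-mono rest)
  ... | yes Px | no ¬Qx = contradiction (P⇒Q Px) ¬Qx
  ... | no _ | yes _ = m≤n⇒m≤1+n (count-mono rest)
  ... | no _ | no _ = count-mono rest

  count-∪ : (∀ {x} → P x → ¬ Q x) → ∀ xs → count (P? ∪? Q?) xs ≡ count P? xs + count Q? xs
  count-∪ disjoint [] = refl
  count-∪ disjoint (x ∷ xs) with P? x | Q? x
  ... | yes Px | yes Qx = contradiction Qx (disjoint Px)
  ... | yes _ | no _ = cong suc (count-∪ disjoint xs)
  ... | no _ | yes _ = trans (cong suc (count-∪ disjoint xs)) (sym (+-suc _ _))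
  ... | no _ | no _ = count-∪ disjoint xs

lead : List ℕ → ℕ
lead [] = 0
lead (x ∷ _) = x

lead-insertDesc : ∀ x ys → lead (insertDesc x ys) ≡ x ⊔ lead ys
lead-insertDesc x [] = sym (⊔-identityʳ x)
lead-insertDesc x (y ∷ ys) with y ≤ᵇ x | ≤ᵇ-reflects-≤ y x
... | true | ofʸ y≤x = sym (m≥n⇒m⊔n≡m y≤x)
... | false | ofⁿ y≰x = sym (m≤n⇒m⊔n≡n (<⇒≤ (≰⇒> y≰x)))

∈⇒≤-lead-sortDesc : ∀ {x xs} → x ∈ xs → x ≤ lead (sortDesc xs)
∈⇒≤-lead-sortDesc {x} {_ ∷ xs} (here refl) =
  subst (x ≤_) (sym (lead-insertDesc x (sortDesc xs))) (m≤m⊔n x _)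
∈⇒≤-lead-sortDesc {x} {y ∷ xs} (there x∈xs) =
  subst (x ≤_) (sym (lead-insertDesc y (sortDesc xs))) (≤-trans (∈⇒≤-lead-sortDesc x∈xs) (m≤n⊔m y _))

lead-sortDesc≤ : ∀ {m xs} → All (_≤ m) xs → lead (sortDesc xs) ≤ m
lead-sortDesc≤ [] = z≤n
lead-sortDesc≤ {xs = x ∷ xs} (x≤m ∷ xs≤m) =
  subst (_≤ _) (sym (lead-insertDesc x (sortDesc xs))) (⊔-lub x≤m (lead-sortDesc≤ xs≤m))

lead-mono : ∀ {w w'} → w ≡ w' ⊎ LexLt w w' → lead w ≤ lead w'
lead-mono (inj₁ refl) = ≤-refl
lead-mono (inj₂ (here a<b)) = <⇒≤ a<b
lead-mono (inj₂ (there _)) = ≤-refl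

classSize≤lead-colorWord : ∀ n c k → classSize n c k ≤ lead (colorWord n c)
classSize≤lead-colorWord n c k with filter (λ v → c v ≟ k) (allVertices n) in eq
... | [] = z≤n
... | v ∷ _ with ∈-filter⁻ (λ v → c v ≟ k) {xs = allVertices n} (subst (v ∈_) (sym eq) (here refl))
...   | v∈Π , refl = subst (_≤ lead (colorWord n c)) (cong length eq)
        (∈⇒≤-lead-sortDesc (∈-map⁺ (classSize n c) (∈-deduplicate⁺ _≟_ (∈-map⁺ c v∈Π))))

lead-colorWord≤ : ∀ n c {m} → Bounded n c m → lead (colorWord n c) ≤ m
lead-colorWord≤ n c bounded = lead-sortDesc≤ (map⁺ (All.universal bounded (usedColours n c)))

lexMin-bounded : ∀ {n L c c' m} → LexMin n L c → ProperLColoring n L c' → Bounded n c' m → Bounded n c m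
lexMin-bounded {n} {c = c} {c'} lexMin proper' bounded' k = begin
  classSize n c k          ≤⟨ classSize≤lead-colorWord n c k ⟩
  lead (colorWord n c)     ≤⟨ lead-mono (lexMin c' proper') ⟩
  lead (colorWord n c')    ≤⟨ lead-colorWord≤ n c' bounded' ⟩
  _                        ∎
  where open ≤-Reasoning

Colour : Set
Colour = Fin 3

pattern red = zero
pattern green = suc zero
pattern blue = suc (suc zero)

rotate : Colour → Colour
rotate red = green
rotate green = blue
rotate blue = red

rotate-≢ : ∀ x → rotate x ≢ x
rotate-≢ red ()
rotate-≢ green ()
rotate-≢ blue ()

rotate²-≢ : ∀ x → rotate (rotate x) ≢ x
rotate²-≢ red ()
rotate²-≢ green ()
rotate²-≢ blue ()

rotate³ : ∀ x → rotate (rotate (rotate x)) ≡ x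
rotate³ red = refl
rotate³ green = refl
rotate³ blue = refl

rotate-injective : ∀ {x y} → rotate x ≡ rotate y → x ≡ y
rotate-injective {x} {y} e = trans (sym (rotate³ x)) (trans (cong (rotate ∘ rotate) e) (rotate³ y))

avoidRed : Colour → Colour
avoidRed red = green
avoidRed x = x

avoidRed-≢-red : ∀ x → avoidRed x ≢ red
avoidRed-≢-red red ()
avoidRed-≢-red green ()
avoidRed-≢-red blue ()

avoidRed∘rotate-≢ : ∀ x → avoidRed (rotate x) ≢ x
avoidRed∘rotate-≢ red ()
avoidRed∘rotate-≢ green ()
avoidRed∘rotate-≢ blue ()

cyclic : ℕ → Colour
cyclic 0 = red
cyclic 1 = green
cyclic 2 = blue
cyclic (suc (suc (suc i))) = cyclic i

cyclic-suc : ∀ i → cyclic (suc i) ≡ rotate (cyclic i)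
cyclic-suc 0 = refl
cyclic-suc 1 = refl
cyclic-suc 2 = refl
cyclic-suc (suc (suc (suc i))) = cyclic-suc i

cyclic-block : ∀ s q → cyclic (toℕ s + q * 3) ≡ s
cyclic-block red zero = refl
cyclic-block green zero = refl
cyclic-block blue zero = refl
cyclic-block red (suc q) = cyclic-block red q
cyclic-block green (suc q) = cyclic-block green q
cyclic-block blue (suc q) = cyclic-block blue q

cyclic-before-multiple : ∀ {j} q → suc j ≡ q * 3 → cyclic j ≡ blue
cyclic-before-multiple (suc q) e = trans (cong cyclic (suc-injective e)) (cyclic-block blue q)

count-cyclic : ∀ s q → q ≤ count (λ i → cyclic i ≟ᶠ s) (upTo (q * 3))
count-cyclic s zero = z≤n
count-cyclic s (suc q) = begin
  suc q                                     ≤⟨ s≤s (count-cyclic s q) ⟩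
  suc (count P? (upTo (q * 3)))             ≤⟨ s≤s (count-upTo-mono P? (m≤n+m (q * 3) (toℕ s))) ⟩
  suc (count P? (upTo (toℕ s + q * 3)))     ≡⟨ count-upTo-hit P? (cyclic-block s q) ⟨
  count P? (upTo (suc (toℕ s) + q * 3))     ≤⟨ count-upTo-mono P? (+-monoˡ-≤ (q * 3) (toℕ<n s)) ⟩
  count P? (upTo (suc q * 3))               ∎
  where
  open ≤-Reasoning
  P? : Decidable (λ i → cyclic i ≡ s)
  P? i = cyclic i ≟ᶠ s

-- rim n j colours u_{j+1}; the last vertex is recoloured when it would clash with the red u_1.
rim : ℕ → ℕ → Colour
rim n j with suc j ≟ n
... | yes _ = avoidRed (cyclic j)
... | no _ = cyclic j

rim-consecutive : ∀ n x → suc x < n → rim n x ≢ rim n (suc x)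
rim-consecutive n x 2+x≤n with suc x ≟ n | suc (suc x) ≟ n
... | yes 1+x≡n | _ = contradiction 1+x≡n (<⇒≢ 2+x≤n)
... | no _ | yes _ = ≢-sym (subst (λ y → avoidRed y ≢ cyclic x) (sym (cyclic-suc x)) (avoidRed∘rotate-≢ (cyclic x)))
... | no _ | no _ = ≢-sym (subst (_≢ cyclic x) (sym (cyclic-suc x)) (rotate-≢ (cyclic x)))

rim-adjacent : ∀ {n x y} → y ≡ suc x → y < n → rim n x ≢ rim n y
rim-adjacent {n} {x} refl = rim-consecutive n x

rim-zero : ∀ {n} → 2 ≤ n → rim n 0 ≡ red
rim-zero {n} 2≤n with 1 ≟ n
... | yes 1≡n = contradiction 1≡n (<⇒≢ 2≤n)
... | no _ = refl

rim-last : ∀ {n j} → suc j ≡ n → rim n j ≢ red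
rim-last {n} {j} 1+j≡n with suc j ≟ n
... | yes _ = avoidRed-≢-red (cyclic j)
... | no 1+j≢n = contradiction 1+j≡n 1+j≢n

rim-proper : ∀ {n} → 2 ≤ n → ∀ {i j} → CycAdj n i j → rim n (toℕ i) ≢ rim n (toℕ j)
rim-proper 2≤n {j = j} (inj₁ j≡1+i) = rim-adjacent j≡1+i (toℕ<n j)
rim-proper 2≤n {i = i} (inj₂ (inj₁ i≡1+j)) = ≢-sym (rim-adjacent i≡1+j (toℕ<n i))
rim-proper {n} 2≤n (inj₂ (inj₂ (inj₁ (i≡0 , 1+j≡n)))) e =
  rim-last 1+j≡n (trans (sym e) (trans (cong (rim n) i≡0) (rim-zero 2≤n)))
rim-proper {n} 2≤n (inj₂ (inj₂ (inj₂ (j≡0 , 1+i≡n)))) e =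
  rim-last 1+i≡n (trans e (trans (cong (rim n) j≡0) (rim-zero 2≤n)))

rim≡cyclic : ∀ n q j → j < q * 3 → q * 3 ≤ n → rim n j ≡ cyclic j
rim≡cyclic n q j j<3q 3q≤n with suc j ≟ n
... | no _ = refl
... | yes 1+j≡n = trans (cong avoidRed cyclic-j) (sym cyclic-j)
  where
  cyclic-j : cyclic j ≡ blue
  cyclic-j = cyclic-before-multiple q (≤-antisym j<3q (subst (q * 3 ≤_) (sym 1+j≡n) 3q≤n))

toℕ-allFin : ∀ n → map toℕ (allFin n) ≡ upTo n
toℕ-allFin n = trans (map-tabulate _ toℕ) (tabulate-toℕ n (λ i → i))
  where
  tabulate-toℕ : ∀ n (f : ℕ → ℕ) → tabulate {n = n} (f ∘ toℕ) ≡ applyUpTo f n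
  tabulate-toℕ zero f = refl
  tabulate-toℕ (suc n) f = cong (f 0 ∷_) (tabulate-toℕ n (f ∘ suc))

count-rim : ∀ n s → n / 3 ≤ count (λ j → rim n (toℕ j) ≟ᶠ s) (allFin n)
count-rim n s = begin
  q                                              ≤⟨ count-cyclic s q ⟩
  count (λ j → cyclic j ≟ᶠ s) (upTo (q * 3))     ≤⟨ count-mono _ _ (applyUpTo⁺₁ _ (q * 3) agree) ⟩
  count (λ j → rim n j ≟ᶠ s) (upTo (q * 3))      ≤⟨ count-upTo-mono _ (m/n*n≤m n 3) ⟩
  count (λ j → rim n j ≟ᶠ s) (upTo n)            ≡⟨ cong (count _) (toℕ-allFin n) ⟨
  count (λ j → rim n j ≟ᶠ s) (map toℕ (allFin n)) ≡⟨ count-map _ toℕ (allFin n) ⟩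
  count (λ j → rim n (toℕ j) ≟ᶠ s) (allFin n)   ∎
  where
  open ≤-Reasoning
  q : ℕ
  q = n / 3
  agree : ∀ {j} → j < q * 3 → cyclic j ≡ s → rim n j ≡ s
  agree j<3q refl = rim≡cyclic n q _ j<3q (m/n*n≤m n 3)

n/3+ceil2n/3≡n : ∀ n → n / 3 + ceil2n/3 n ≡ n
n/3+ceil2n/3≡n 0 = refl
n/3+ceil2n/3≡n 1 = refl
n/3+ceil2n/3≡n 2 = refl
n/3+ceil2n/3≡n (suc (suc (suc m))) = begin
  (3 + m) / 3 + ceil2n/3 (3 + m)             ≡⟨ cong₂ _+_ (+3/3 m) (cong (_/ 3) (double+2 m)) ⟩
  suc (m / 3) + (3 + (3 + (2 * m + 2))) / 3  ≡⟨ cong (suc (m / 3) +_) (trans (+3/3 (3 + (2 * m + 2))) (cong suc (+3/3 (2 * m + 2)))) ⟩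
  suc (m / 3) + (2 + ceil2n/3 m)             ≡⟨ cong suc (trans (+-suc _ _) (cong suc (+-suc _ _))) ⟩
  3 + (m / 3 + ceil2n/3 m)                   ≡⟨ cong (3 +_) (n/3+ceil2n/3≡n m) ⟩
  3 + m                                      ∎
  where
  open ≡-Reasoning
  +3/3 : ∀ x → (3 + x) / 3 ≡ suc (x / 3)
  +3/3 x = m/n≡1+[m∸n]/n {3 + x} (s≤s (s≤s (s≤s z≤n)))
  double+2 : ∀ x → 2 * (3 + x) + 2 ≡ 3 + (3 + (2 * x + 2))
  double+2 = solve-∀

prismColouring : (n : ℕ) → Vertex n → Colour
prismColouring n (false , i) = rim n (toℕ i)
prismColouring n (true , i) = rotate (rim n (toℕ i))

prismColouring-proper : ∀ {n} → 2 ≤ n → ∀ u v → Adj n u v → prismColouring n u ≢ prismColouring n v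
prismColouring-proper 2≤n (false , i) (false , j) (inj₁ (_ , adj)) = rim-proper 2≤n adj
prismColouring-proper 2≤n (true , i) (true , j) (inj₁ (_ , adj)) = rim-proper 2≤n adj ∘ rotate-injective
prismColouring-proper 2≤n (false , i) (false , j) (inj₂ (f≢f , _)) = contradiction refl f≢f
prismColouring-proper 2≤n (true , i) (true , j) (inj₂ (t≢t , _)) = contradiction refl t≢t
prismColouring-proper 2≤n (false , i) (true , .i) (inj₂ (_ , refl)) = ≢-sym (rotate-≢ _)
prismColouring-proper 2≤n (true , i) (false , .i) (inj₂ (_ , refl)) = rotate-≢ _

count-allVertices : ∀ n {P : Pred (Vertex n) ℓ} (P? : Decidable P) →
  count P? (allVertices n) ≡ count (P? ∘ (true ,_)) (allFin n) + count (P? ∘ (false ,_)) (allFin n)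
count-allVertices n P? = begin
  count P? (outer ++ inner ++ [])                         ≡⟨ count-++ P? outer (inner ++ []) ⟩
  count P? outer + count P? (inner ++ [])                 ≡⟨ cong (λ vs → count P? outer + count P? vs) (++-identityʳ inner) ⟩
  count P? outer + count P? inner                         ≡⟨ cong₂ _+_ (count-map P? _ (allFin n)) (count-map P? _ (allFin n)) ⟩
  count (P? ∘ (true ,_)) (allFin n) + count (P? ∘ (false ,_)) (allFin n) ∎
  where
  open ≡-Reasoning
  outer inner : List (Vertex n)
  outer = map (true ,_) (allFin n)
  inner = map (false ,_) (allFin n)

-- A column u_j v_j meets colour t at most once, and misses it when u_j has colour rotate t,
-- which by count-rim happens for at least n/3 columns.
prismColouring-balanced : ∀ n t → count (λ v → prismColouring n v ≟ᶠ t) (allVertices n) ≤ ceil2n/3 n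
prismColouring-balanced n t = +-cancelʳ-≤ (n / 3) _ _ (begin
  count (λ v → prismColouring n v ≟ᶠ t) (allVertices n) + n / 3  ≡⟨ cong (_+ n / 3) (count-allVertices n _) ⟩
  count V? cols + count U? cols + n / 3                          ≤⟨ +-monoʳ-≤ _ (count-rim n (rotate t)) ⟩
  count V? cols + count U? cols + count W? cols                  ≡⟨ cong (_+ count W? cols) (count-∪ V? U? V⇒¬U cols) ⟨
  count (V? ∪? U?) cols + count W? cols                          ≡⟨ count-∪ (V? ∪? U?) W? V∪U⇒¬W cols ⟨
  count ((V? ∪? U?) ∪? W?) cols                                  ≤⟨ length-filter _ cols ⟩
  length cols                                                    ≡⟨ length-tabulate _ ⟩
  n                                                              ≡⟨ n/3+ceil2n/3≡n n ⟨
  n / 3 + ceil2n/3 n                                             ≡⟨ +-comm (n / 3) _ ⟩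
  ceil2n/3 n + n / 3                                             ∎)
  where
  open ≤-Reasoning
  cols : List (Fin n)
  cols = allFin n
  colour : Fin n → Colour
  colour j = rim n (toℕ j)
  V? : Decidable (λ j → rotate (colour j) ≡ t)
  V? j = rotate (colour j) ≟ᶠ t
  U? : Decidable (λ j → colour j ≡ t)
  U? j = colour j ≟ᶠ t
  W? : Decidable (λ j → colour j ≡ rotate t)
  W? j = colour j ≟ᶠ rotate t
  V⇒¬U : ∀ {j} → rotate (colour j) ≡ t → colour j ≢ t
  V⇒¬U {j} v≡t u≡t = rotate-≢ (colour j) (trans v≡t (sym u≡t))
  V∪U⇒¬W : ∀ {j} → rotate (colour j) ≡ t ⊎ colour j ≡ t → colour j ≢ rotate t
  V∪U⇒¬W (inj₁ v≡t) u≡rt = rotate²-≢ t (trans (cong rotate (sym u≡rt)) v≡t)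
  V∪U⇒¬W (inj₂ u≡t) u≡rt = rotate-≢ t (trans (sym u≡rt) u≡t)

lookup-injective : ∀ {xs : List A} → Unique xs → ∀ {i j} → lookup xs i ≡ lookup xs j → i ≡ j
lookup-injective (_ ∷ _) {zero} {zero} _ = refl
lookup-injective (x∉xs ∷ _) {zero} {suc j} e = contradiction e (All.lookup x∉xs (∈-lookup j))
lookup-injective (x∉xs ∷ _) {suc i} {zero} e = contradiction (sym e) (All.lookup x∉xs (∈-lookup i))
lookup-injective (_ ∷ xs-unique) {suc i} {suc j} e = cong suc (lookup-injective xs-unique e)

lookup∘-bounded : ∀ {n m} {xs : List ℕ} → Unique xs → (κ : Vertex n → Fin (length xs)) →
  (∀ t → count (λ v → κ v ≟ᶠ t) (allVertices n) ≤ m) → Bounded n (lookup xs ∘ κ) m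
lookup∘-bounded {n} {xs = xs} xs-unique κ κ-bounded k with k ∈? xs
... | yes k∈xs = ≤-trans (count-mono _ _ (All.universal κ≡index (allVertices n))) (κ-bounded (index k∈xs))
  where
  κ≡index : ∀ v → lookup xs (κ v) ≡ k → κ v ≡ index k∈xs
  κ≡index v e = lookup-injective xs-unique (trans e (lookup-index k∈xs))
... | no k∉xs = ≤-trans (≤-reflexive (cong length (filter-none _ (All.universal lookup≢k (allVertices n))))) z≤n
  where
  lookup≢k : ∀ v → lookup xs (κ v) ≢ k
  lookup≢k v e = k∉xs (subst (_∈ xs) e (∈-lookup (κ v)))

balancedColouring : ∀ {n} → 2 ≤ n → (xs : List ℕ) → length xs ≡ 3 × Unique xs →
  Σ (Vertex n → ℕ) λ c → (∀ v → c v ∈ xs) × (∀ u v → Adj n u v → c u ≢ c v) × Bounded n c (ceil2n/3 n)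
balancedColouring {n} 2≤n xs@(_ ∷ _ ∷ _ ∷ []) (refl , xs-unique) =
  lookup xs ∘ prismColouring n ,
  (λ v → ∈-lookup (prismColouring n v)) ,
  (λ u v adj → prismColouring-proper 2≤n u v adj ∘ lookup-injective xs-unique) ,
  lookup∘-bounded xs-unique (prismColouring n) (prismColouring-balanced n)

lemma4p1 : (n : ℕ) → 6 ≤ n → (L : Vertex n → List ℕ) → ThreeUniform n L →
    (c : Vertex n → ℕ) → ProperLColoring n L c → LexMin n L c →
    (∀ u v (x : ℕ) → x ∈ L u → x ∈ L v) →
    Bounded n c (ceil2n/3 n)
lemma4p1 zero () _ _ _ _ _ _
lemma4p1 (suc m) 6≤n L uniform c _ lexMin sameLists
  with balancedColouring (≤-trans (s≤s (s≤s z≤n)) 6≤n) (L (false , zero)) (uniform (false , zero))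
... | c' , c'∈L , c'-proper , c'-bounded =
  lexMin-bounded lexMin ((λ v → sameLists (false , zero) v (c' v) (c'∈L v)) , c'-proper) c'-bounded
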